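{- For every $n\ge 1$, $|\mathcal{DRS}_n(132,213)|=F_{n+1}$.
   Context: For $\sigma\in\mathfrak{S}_n$, a double descent is an index $i$ with $\sigma_i>\sigma_{i+1}>\sigma_{i+2}$. The permutation $\sigma$ is simsun if for every $k$, the subword of $\sigma$ consisting of the letters in $\{1,\dots,k\}$ (in the order they appear in $\sigma$) has no double descent. For $\omega\in\mathfrak{S}_t$, $\sigma$ contains an $\omega$-pattern if there are indices $i_1<\cdots<i_t$ with $\sigma_{i_j}<\sigma_{i_k}$ iff $\omega_j<\omega_k$; otherwise $\sigma$ avoids $\omega$. $\mathcal{DRS}_n(132,213)$ is the set of $\sigma\in\mathfrak{S}_n$ that avoid both $132$ and $213$, are simsun, and whose inverse $\sigma^{ -1}$ is simsun. $F_n$ is the Fibonacci number with $F_1=F_2=1$, $F_{n}=F_{n-1}+F_{n-2}$. -}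

module Defs where

open import Data.Nat using (ℕ; zero; suc; _+_; _<_; _≤?_; _≟_)
open import Data.List using (List; []; _∷_; map; upTo; filter; length)
open import Data.List.Relation.Binary.Permutation.Propositional using (_↭_)
open import Data.List.Relation.Binary.Sublist.Propositional using (_⊆_)
open import Data.List.Relation.Binary.Pointwise using (Pointwise)
open import Data.Product using (Σ; _×_; ∃)
open import Data.Unit using (⊤)
open import Data.Empty using (⊥)
open import Function.Bundles using (_⇔_)
open import Relation.Nullary using (¬_; yes; no)

F : ℕ → ℕ
F zero = 0
F (suc zero) = 1
F (suc (suc n)) = F (suc n) + F n

[1‥_] : ℕ → List ℕ
[1‥ n ] = map suc (upTo n)

-- σ ∈ 𝔖_n, in one-line notation σ₁ σ₂ … σₙ
IsPerm : ℕ → List ℕ → Set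
IsPerm n σ = σ ↭ [1‥ n ]

data HasDoubleDescent : List ℕ → Set where
  here  : ∀ {a b c xs} → b < a → c < b → HasDoubleDescent (a ∷ b ∷ c ∷ xs)
  there : ∀ {x xs} → HasDoubleDescent xs → HasDoubleDescent (x ∷ xs)

restrict : ℕ → List ℕ → List ℕ
restrict k σ = filter (_≤? k) σ

Simsun : List ℕ → Set
Simsun σ = ∀ k → ¬ HasDoubleDescent (restrict k σ)

-- 1-based position of the letter j in σ (meaningful when j occurs in σ)
position : ℕ → List ℕ → ℕ
position j [] = 0
position j (x ∷ xs) with j ≟ x
... | yes _ = 1
... | no  _ = suc (position j xs)

inverse : List ℕ → List ℕ
inverse σ = map (λ j → position j σ) [1‥ length σ ]

-- τ and ω are order-isomorphic words: same length and
-- τ_j < τ_k iff ω_j < ω_k for all positions j, k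
OrderIso : List ℕ → List ℕ → Set
OrderIso [] [] = ⊤
OrderIso [] (_ ∷ _) = ⊥
OrderIso (_ ∷ _) [] = ⊥
OrderIso (x ∷ xs) (y ∷ ys) =
  Pointwise (λ x' y' → ((x < x') ⇔ (y < y')) × ((x' < x) ⇔ (y' < y))) xs ys
  × OrderIso xs ys

Contains : List ℕ → List ℕ → Set
Contains ω σ = ∃ λ τ → τ ⊆ σ × OrderIso τ ω

Avoids : List ℕ → List ℕ → Set
Avoids ω σ = ¬ Contains ω σ

InDRS : ℕ → List ℕ → Set
InDRS n σ = IsPerm n σ × Avoids (1 ∷ 3 ∷ 2 ∷ []) σ × Avoids (2 ∷ 1 ∷ 3 ∷ [])  σ
            × Simsun σ × Simsun (inverse σ)

module Submission where

-- A composition of n into blocks b₁, …, b_r determines the layered permutation whose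
-- blocks are increasing runs of consecutive values, each block lying above all later
-- ones (e.g. blocks 2,1 give 2 3 1).  The proof establishes in turn:
--   1. a permutation avoids 132 and 213 iff it is layered (`layered-avoids`,
--      `avoider-is-layered`: the first letter a forces the run a, a+1, …, n);
--   2. a layered permutation has a double descent iff some interior block has size 1
--      (`admissible⇒no-dd`, `no-dd⇒admissible`); restricting it to {1,…,k} gives the
--      layered permutation of a cut-down composition (`restrict-layered`), so it is
--      simsun iff its composition is admissible (no interior block of size 1);
--   3. its inverse is the layered permutation of the reversed composition
--      (`inverse-layered`), and admissibility is reversal invariant;
--   4. the admissible compositions of n satisfy the Fibonacci recursion, according to
--      whether the first block has size ≥ 2 or size 1 (`admissibleCompositions`).

open import Defs
open import Data.Nat using (ℕ; zero; suc; _+_; _∸_; _⊓_; _≤_; _<_; _≥_; z≤n; s≤s; s≤s⁻¹; z<s; s<s)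
open import Data.Nat.Properties
open import Data.Nat.Induction using (<-wellFounded)
open import Induction.WellFounded using (Acc; acc)
open import Data.List using (List; []; _∷_; _++_; map; length; applyUpTo; reverse; initLast; _∷ʳ′_)
import Data.List.Properties as List
open import Data.List.Membership.Propositional using (_∈_)
open import Data.List.Membership.Propositional.Properties using (∈-map⁺; ∈-map⁻; ∈-++⁺ˡ; ∈-++⁺ʳ; ∈-++⁻)
open import Data.List.Relation.Unary.Any as Any using (here; there)
open import Data.List.Relation.Unary.All as All using (All; []; _∷_)
open import Data.List.Relation.Unary.Unique.Propositional using (Unique; []; _∷_)
import Data.List.Relation.Unary.Unique.Propositional.Properties as Unique
open import Data.List.Relation.Binary.Permutation.Propositional
  using (_↭_; ↭-refl; ↭-sym; ↭⇒↭ₛ; module PermutationReasoning)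
open import Data.List.Relation.Binary.Permutation.Propositional.Properties
  using (∈-resp-↭; All-resp-↭; ++⁺ˡ; ++-comm; drop-∷; ↭-length; ↭-reverse)
import Data.List.Relation.Binary.Permutation.Setoid.Properties as Permutationₛ
open import Data.List.Relation.Binary.Sublist.Propositional using (_⊆_; ⊆-refl; ⊆-trans)
import Data.List.Relation.Binary.Sublist.Propositional.Properties as Sublist
open import Data.List.Relation.Binary.Sublist.Heterogeneous using ([]; _∷_; _∷ʳ_; fromAny)
open import Data.List.Relation.Binary.Pointwise using ([]; _∷_)
open import Data.Product using (Σ; _×_; _,_; proj₁; proj₂; ∃; ∃₂)
open import Data.Sum using (_⊎_; inj₁; inj₂)
open import Data.Unit using (⊤; tt)
open import Data.Empty using (⊥; ⊥-elim)
open import Function using (_∘_)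
open import Function.Bundles using (_⇔_; mk⇔; Equivalence)
open import Relation.Nullary using (¬_; yes; no)
open import Relation.Binary.PropositionalEquality
  using (_≡_; _≢_; refl; sym; trans; cong; cong₂; subst; setoid; module ≡-Reasoning)

interval : ℕ → ℕ → List ℕ
interval lo zero    = []
interval lo (suc n) = lo ∷ interval (suc lo) n

∈-interval⁻ : ∀ {x} lo n → x ∈ interval lo n → lo ≤ x × x < lo + n
∈-interval⁻ lo (suc n) (here refl) = ≤-refl , m<m+n lo z<s
∈-interval⁻ {x} lo (suc n) (there x∈) with ∈-interval⁻ (suc lo) n x∈
... | lo<x , x<end = <⇒≤ lo<x , subst (x <_) (sym (+-suc lo n)) x<end

∈-interval⁺ : ∀ {x} lo n → lo ≤ x → x < lo + n → x ∈ interval lo n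
∈-interval⁺ {x} lo zero lo≤x x<end = ⊥-elim (<⇒≱ (subst (x <_) (+-identityʳ lo) x<end) lo≤x)
∈-interval⁺ {x} lo (suc n) lo≤x x<end with x ≟ lo
... | yes x≡lo = here x≡lo
... | no  x≢lo = there (∈-interval⁺ (suc lo) n (≤∧≢⇒< lo≤x (x≢lo ∘ sym)) (subst (x <_) (+-suc lo n) x<end))

length-interval : ∀ lo n → length (interval lo n) ≡ n
length-interval lo zero    = refl
length-interval lo (suc n) = cong suc (length-interval (suc lo) n)

interval-unique : ∀ lo n → Unique (interval lo n)
interval-unique lo zero    = []
interval-unique lo (suc n) =
  All.tabulate (λ x∈ lo≡x → <-irrefl lo≡x (proj₁ (∈-interval⁻ (suc lo) n x∈))) ∷ interval-unique (suc lo) n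

interval-++ : ∀ lo a b → interval lo a ++ interval (lo + a) b ≡ interval lo (a + b)
interval-++ lo zero    b = cong (λ l → interval l b) (+-identityʳ lo)
interval-++ lo (suc a) b =
  cong (lo ∷_) (trans (cong (λ l → interval (suc lo) a ++ interval l b) (+-suc lo a)) (interval-++ (suc lo) a b))

interval-split : ∀ m k → interval 1 m ++ interval (suc m) k ≡ interval 1 (k + m)
interval-split m k = trans (interval-++ 1 m k) (cong (interval 1) (+-comm m k))

interval-extend : ∀ lo n (ys : List ℕ) → interval lo n ++ (lo + n) ∷ ys ≡ interval lo (suc n) ++ ys
interval-extend lo zero    ys = cong (_∷ ys) (+-identityʳ lo)
interval-extend lo (suc n) ys =
  cong (lo ∷_) (trans (cong (λ l → interval (suc lo) n ++ l ∷ ys) (+-suc lo n)) (interval-extend (suc lo) n ys))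

[1‥n]≡interval : ∀ n → [1‥ n ] ≡ interval 1 n
[1‥n]≡interval n = trans (List.map-upTo suc n) (applyUpTo-interval suc 1 n (λ _ → refl))
  where
  applyUpTo-interval : ∀ (f : ℕ → ℕ) lo n → (∀ i → f i ≡ lo + i) → applyUpTo f n ≡ interval lo n
  applyUpTo-interval f lo zero    f≗ = refl
  applyUpTo-interval f lo (suc n) f≗ = cong₂ _∷_ (trans (f≗ 0) (+-identityʳ lo))
    (applyUpTo-interval (f ∘ suc) (suc lo) n (λ i → trans (f≗ (suc i)) (+-suc lo i)))

isPerm⇒↭interval : ∀ {n σ} → IsPerm n σ → σ ↭ interval 1 n
isPerm⇒↭interval {n} {σ} = subst (σ ↭_) ([1‥n]≡interval n)

-- A composition c = p₁ ∷ … ∷ p_r is stored with each part decreased by one: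
-- it has blocks of sizes p₁+1, …, p_r+1 and total size `total c`.
total : List ℕ → ℕ
total []      = 0
total (p ∷ c) = suc p + total c

layered : List ℕ → List ℕ
layered []      = []
layered (p ∷ c) = interval (suc (total c)) (suc p) ++ layered c

layered-↭ : ∀ c → layered c ↭ interval 1 (total c)
layered-↭ []      = ↭-refl
layered-↭ (p ∷ c) = begin
  top ++ layered c            ↭⟨ ++⁺ˡ top (layered-↭ c) ⟩
  top ++ interval 1 (total c) ↭⟨ ++-comm top _ ⟩
  interval 1 (total c) ++ top ≡⟨ interval-split (total c) (suc p) ⟩
  interval 1 (total (p ∷ c))  ∎
  where
  open PermutationReasoning
  top = interval (suc (total c)) (suc p)

∈-layered⁻ : ∀ {w} c → w ∈ layered c → 1 ≤ w × w < suc (total c)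
∈-layered⁻ c w∈ = ∈-interval⁻ 1 (total c) (∈-resp-↭ (layered-↭ c) w∈)

length-layered : ∀ c → length (layered c) ≡ total c
length-layered c = trans (↭-length (layered-↭ c)) (length-interval 1 (total c))

-- The first letter of `layered c` determines `total` of the tail and its length
-- then determines the first part, so `layered` is injective.
layered-injective : ∀ c d → layered c ≡ layered d → c ≡ d
layered-injective []      []      _  = refl
layered-injective (p ∷ c) (q ∷ d) eq = cong₂ _∷_ p≡q (layered-injective c d same-rest)
  where
  open ≡-Reasoning
  tc≡td : total c ≡ total d
  tc≡td = suc-injective (List.∷-injectiveˡ eq)
  p≡q : p ≡ q
  p≡q = suc-injective (+-cancelʳ-≡ (total c) (suc p) (suc q) (begin
    suc p + total c          ≡⟨ length-layered (p ∷ c) ⟨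
    length (layered (p ∷ c)) ≡⟨ cong length eq ⟩
    length (layered (q ∷ d)) ≡⟨ length-layered (q ∷ d) ⟩
    suc q + total d          ≡⟨ cong (suc q +_) tc≡td ⟨
    suc q + total c          ∎))
  same-top : interval (suc (total c)) (suc p) ≡ interval (suc (total d)) (suc q)
  same-top = cong₂ (λ t r → interval (suc t) (suc r)) tc≡td p≡q
  same-rest : layered c ≡ layered d
  same-rest = List.++-cancelˡ _ (layered c) (layered d) (trans (cong (_++ layered c) (sym same-top)) eq)
layered-injective []      (_ ∷ _) ()
layered-injective (_ ∷ _) []      ()

AvoidsBoth : List ℕ → Set
AvoidsBoth σ = Avoids (1 ∷ 3 ∷ 2 ∷ []) σ × Avoids (2 ∷ 1 ∷ 3 ∷ []) σ

avoids-⊆ : ∀ {ω ρ σ} → ρ ⊆ σ → Avoids ω σ → Avoids ω ρ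
avoids-⊆ ρ⊆σ av (τ , τ⊆ρ , iso) = av (τ , ⊆-trans τ⊆ρ ρ⊆σ , iso)

avoidsBoth-⊆ : ∀ {ρ σ} → ρ ⊆ σ → AvoidsBoth σ → AvoidsBoth ρ
avoidsBoth-⊆ ρ⊆σ (av₁ , av₂) = avoids-⊆ ρ⊆σ av₁ , avoids-⊆ ρ⊆σ av₂

both : ∀ {A B : Set} → A → B → A ⇔ B
both a b = mk⇔ (λ _ → b) (λ _ → a)

neither : ∀ {A B : Set} → ¬ A → ¬ B → A ⇔ B
neither ¬a ¬b = mk⇔ (⊥-elim ∘ ¬a) (⊥-elim ∘ ¬b)

1<2 : 1 < 2
1<2 = s<s z<s

1<3 : 1 < 3
1<3 = s<s z<s

2<3 : 2 < 3
2<3 = s<s (s<s z<s)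

is132 : ∀ {x y z} → OrderIso (x ∷ y ∷ z ∷ []) (1 ∷ 3 ∷ 2 ∷ []) ⇔ (x < z × z < y)
is132 = mk⇔ (λ { ((_ ∷ (x<z⇔ , _) ∷ []) , ((_ , z<y⇔) ∷ []) , _) → Equivalence.from x<z⇔ 1<2 , Equivalence.from z<y⇔ 2<3 })
            (λ { (x<z , z<y) → let x<y = <-trans x<z z<y in
                   ((both x<y 1<3 , neither (<-asym x<y) (<-asym 1<3))
                    ∷ (both x<z 1<2 , neither (<-asym x<z) (<-asym 1<2)) ∷ [])
                 , ((neither (<-asym z<y) (<-asym 2<3) , both z<y 2<3) ∷ []) , [] , tt })

is213 : ∀ {x y z} → OrderIso (x ∷ y ∷ z ∷ []) (2 ∷ 1 ∷ 3 ∷ []) ⇔ (y < x × x < z)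
is213 = mk⇔ (λ { (((_ , y<x⇔) ∷ (x<z⇔ , _) ∷ []) , _) → Equivalence.from y<x⇔ 1<2 , Equivalence.from x<z⇔ 2<3 })
            (λ { (y<x , x<z) → let y<z = <-trans y<x x<z in
                   ((neither (<-asym y<x) (<-asym 1<2) , both y<x 1<2)
                    ∷ (both x<z 2<3 , neither (<-asym x<z) (<-asym 2<3)) ∷ [])
                 , ((both y<z 1<3 , neither (<-asym y<z) (<-asym 1<3)) ∷ []) , [] , tt })

-- An occurrence of a pattern of length 3 in x ∷ ρ either lies in ρ or consists of x
-- followed by two letters of ρ.
avoids-∷ : ∀ {a b c x ρ} → Avoids (a ∷ b ∷ c ∷ []) ρ
  → (∀ {y z} → (y ∷ z ∷ []) ⊆ ρ → ¬ OrderIso (x ∷ y ∷ z ∷ []) (a ∷ b ∷ c ∷ []))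
  → Avoids (a ∷ b ∷ c ∷ []) (x ∷ ρ)
avoids-∷ av no-pair (τ , (_ ∷ʳ τ⊆ρ) , iso)                  = av (τ , τ⊆ρ , iso)
avoids-∷ av no-pair ((_ ∷ _ ∷ _ ∷ []) , (refl ∷ yz⊆ρ) , iso) = no-pair yz⊆ρ iso
avoids-∷ av no-pair ((_ ∷ []) , (refl ∷ _) , (() , _))
avoids-∷ av no-pair ((_ ∷ _ ∷ []) , (refl ∷ _) , ((_ ∷ ()) , _))
avoids-∷ av no-pair ((_ ∷ _ ∷ _ ∷ _ ∷ _) , (refl ∷ _) , ((_ ∷ _ ∷ ()) , _))

pair-in-run-++ : ∀ lo len ρ {y z} → (y ∷ z ∷ []) ⊆ (interval lo len ++ ρ) → (lo ≤ y × y < z) ⊎ z ∈ ρ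
pair-in-run-++ lo zero      ρ yz⊆ = inj₂ (Sublist.Any-resp-⊆ yz⊆ (there (here refl)))
pair-in-run-++ lo (suc len) ρ (_ ∷ʳ yz⊆) with pair-in-run-++ (suc lo) len ρ yz⊆
... | inj₁ (lo<y , y<z) = inj₁ (<⇒≤ lo<y , y<z)
... | inj₂ z∈ρ          = inj₂ z∈ρ
pair-in-run-++ lo (suc len) ρ (refl ∷ z⊆) with ∈-++⁻ (interval (suc lo) len) (Sublist.Any-resp-⊆ z⊆ (here refl))
... | inj₁ z∈run = inj₁ (≤-refl , proj₁ (∈-interval⁻ (suc lo) len z∈run))
... | inj₂ z∈ρ   = inj₂ z∈ρ

-- Prepending a run of values exceeding all letters of ρ preserves avoidance: the two
-- later letters of a 132 or 213 starting in the run would have to be increasing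
-- inside the run, or the last of them would lie in ρ below the run.
avoids-run-++ : ∀ lo len ρ → (∀ {w} → w ∈ ρ → w < lo) → AvoidsBoth ρ → AvoidsBoth (interval lo len ++ ρ)
avoids-run-++ lo zero      ρ ρ<lo av = av
avoids-run-++ lo (suc len) ρ ρ<lo av with avoids-run-++ (suc lo) len ρ (m<n⇒m<1+n ∘ ρ<lo) av
... | av₁ , av₂ = avoids-∷ av₁ no132 , avoids-∷ av₂ no213
  where
  no132 : ∀ {y z} → (y ∷ z ∷ []) ⊆ (interval (suc lo) len ++ ρ) → ¬ OrderIso (lo ∷ y ∷ z ∷ []) (1 ∷ 3 ∷ 2 ∷ [])
  no132 yz⊆ iso with Equivalence.to is132 iso | pair-in-run-++ (suc lo) len ρ yz⊆
  ... | _    , z<y | inj₁ (_ , y<z) = <-asym y<z z<y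
  ... | lo<z , _   | inj₂ z∈ρ       = <-asym (ρ<lo z∈ρ) lo<z
  no213 : ∀ {y z} → (y ∷ z ∷ []) ⊆ (interval (suc lo) len ++ ρ) → ¬ OrderIso (lo ∷ y ∷ z ∷ []) (2 ∷ 1 ∷ 3 ∷ [])
  no213 yz⊆ iso with Equivalence.to is213 iso | pair-in-run-++ (suc lo) len ρ yz⊆
  ... | y<lo , _   | inj₁ (lo<y , _) = <-asym y<lo lo<y
  ... | _    , lo<z | inj₂ z∈ρ        = <-asym (ρ<lo z∈ρ) lo<z

layered-avoids : ∀ c → AvoidsBoth (layered c)
layered-avoids []      = (λ { ([] , [] , ()) }) , (λ { ([] , [] , ()) })
layered-avoids (p ∷ c) =
  avoids-run-++ (suc (total c)) (suc p) (layered c) (proj₂ ∘ ∈-layered⁻ c) (layered-avoids c)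

↭-unique : ∀ {σ} n → σ ↭ interval 1 n → Unique σ
↭-unique n σ↭ = Permutationₛ.Unique-resp-↭ (setoid ℕ) (↭⇒↭ₛ (↭-sym σ↭)) (interval-unique 1 n)

unique-++-disjoint : ∀ (xs : List ℕ) {ys x} → Unique (xs ++ ys) → x ∈ xs → x ∈ ys → ⊥
unique-++-disjoint (_ ∷ xs) (x∉ ∷ _) (here refl) x∈ys = All.lookup x∉ (∈-++⁺ʳ xs x∈ys) refl
unique-++-disjoint (_ ∷ xs) (_ ∷ u) (there x∈xs) x∈ys = unique-++-disjoint xs u x∈xs x∈ys

↭-cancelˡ : ∀ (xs : List ℕ) {ys zs} → xs ++ ys ↭ xs ++ zs → ys ↭ zs
↭-cancelˡ []       ys↭zs = ys↭zs
↭-cancelˡ (x ∷ xs) x∷↭x∷ = ↭-cancelˡ xs (drop-∷ x∷↭x∷)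

-- In a 132- and 213-avoiding word without repeated letters that starts with the run
-- a, …, t-1 (where t = a + suc k), the next letter b is t as soon as t occurs after
-- the run: b < a gives the 213-pattern a b t, b > t the 132-pattern a b t, and
-- a ≤ b < t a repeated letter.
extend-run : ∀ a k b ρ → Unique (interval a (suc k) ++ b ∷ ρ) → AvoidsBoth (interval a (suc k) ++ b ∷ ρ)
  → a + suc k ∈ b ∷ ρ → b ≡ a + suc k
extend-run a k b ρ uniq (av₁ , av₂) t∈ with b ≟ a + suc k
... | yes b≡t = b≡t
... | no  b≢t = ⊥-elim b-is-impossible
  where
  t = a + suc k
  a<t : a < t
  a<t = m<m+n a z<s
  a-b-t : (a ∷ b ∷ t ∷ []) ⊆ interval a (suc k) ++ b ∷ ρ
  a-b-t = refl ∷ Sublist.++⁺ˡ (interval (suc a) k) (refl ∷ fromAny (Any.tail (b≢t ∘ sym) t∈))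
  b-is-impossible : ⊥
  b-is-impossible with a ≤? b | b <? t
  ... | no  a≰b | _       = av₂ (_ , a-b-t , Equivalence.from is213 (≰⇒> a≰b , a<t))
  ... | yes a≤b | yes b<t = unique-++-disjoint (interval a (suc k)) uniq (∈-interval⁺ a (suc k) a≤b b<t) (here refl)
  ... | yes _   | no  b≮t = av₁ (_ , a-b-t , Equivalence.from is132 (a<t , ≤∧≢⇒< (≮⇒≥ b≮t) (b≢t ∘ sym)))

initial-run : ∀ {n a ρ} σ → σ ↭ interval 1 n → AvoidsBoth σ → σ ≡ a ∷ ρ
  → ∀ k → a + k ≤ n → ∃ λ ρ' → σ ≡ interval a (suc k) ++ ρ'
initial-run σ σ↭ av σ≡ zero _ = _ , σ≡
initial-run {n} {a} σ σ↭ av σ≡ (suc k) t≤n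
  with initial-run σ σ↭ av σ≡ k (≤-trans (+-monoʳ-≤ a (n≤1+n k)) t≤n)
... | ρ' , refl with ∈-++⁻ (interval a (suc k)) (∈-resp-↭ (↭-sym σ↭) (∈-interval⁺ 1 n 1≤t (s≤s t≤n)))
  where 1≤t = ≤-trans (s≤s z≤n) (m≤n+m (suc k) a)
...   | inj₁ t∈run = ⊥-elim (<-irrefl refl (proj₂ (∈-interval⁻ a (suc k) t∈run)))
...   | inj₂ t∈ρ' with ρ' | t∈ρ'
...     | []     | ()
...     | b ∷ ρ'' | t∈ = ρ'' , (begin
  interval a (suc k) ++ b ∷ ρ''           ≡⟨ cong (λ x → interval a (suc k) ++ x ∷ ρ'') b≡t ⟩
  interval a (suc k) ++ a + suc k ∷ ρ''   ≡⟨ interval-extend a (suc k) ρ'' ⟩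
  interval a (suc (suc k)) ++ ρ''         ∎)
  where
  open ≡-Reasoning
  b≡t : b ≡ a + suc k
  b≡t = extend-run a k b ρ'' (↭-unique n σ↭) av t∈

first-block : ∀ {n} x ρ → (x ∷ ρ) ↭ interval 1 n → AvoidsBoth (x ∷ ρ)
  → ∃₂ λ m p → ∃ λ ρ' → x ∷ ρ ≡ interval (suc m) (suc p) ++ ρ' × ρ' ↭ interval 1 m × suc p + m ≡ n
first-block {n} x ρ σ↭ av with ∈-interval⁻ 1 n (∈-resp-↭ σ↭ (here refl))
first-block {n} zero    ρ σ↭ av | () , _
first-block {n} (suc m) ρ σ↭ av | _ , s≤s x≤n
  with initial-run (suc m ∷ ρ) σ↭ av refl (n ∸ suc m) (≤-reflexive (m+[n∸m]≡n x≤n))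
... | ρ' , σ≡ = m , p , ρ' , σ≡ , ↭-cancelˡ top ρ'↭ , size
  where
  open PermutationReasoning
  p = n ∸ suc m
  top = interval (suc m) (suc p)
  size : suc p + m ≡ n
  size = trans (sym (+-suc p m)) (m∸n+n≡m x≤n)
  ρ'↭ : top ++ ρ' ↭ top ++ interval 1 m
  ρ'↭ = begin
    top ++ ρ'               ≡⟨ σ≡ ⟨
    suc m ∷ ρ               ↭⟨ σ↭ ⟩
    interval 1 n            ≡⟨ cong (interval 1) size ⟨
    interval 1 (suc p + m)  ≡⟨ interval-split m (suc p) ⟨
    interval 1 m ++ top     ↭⟨ ++-comm (interval 1 m) top ⟩
    top ++ interval 1 m     ∎

avoider-is-layered : ∀ n σ → σ ↭ interval 1 n → AvoidsBoth σ → ∃ λ c → σ ≡ layered c × total c ≡ n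
avoider-is-layered n = go n (<-wellFounded n)
  where
  go : ∀ n → Acc _<_ n → ∀ σ → σ ↭ interval 1 n → AvoidsBoth σ → ∃ λ c → σ ≡ layered c × total c ≡ n
  go n _ [] σ↭ _ = [] , refl , trans (↭-length σ↭) (length-interval 1 n)
  go n (acc smaller) (x ∷ ρ) σ↭ av with first-block x ρ σ↭ av
  ... | m , p , ρ' , σ≡ , ρ'↭ , size
    with go m (smaller (subst (m <_) size (m<n+m m z<s))) ρ' ρ'↭
            (avoidsBoth-⊆ (subst (ρ' ⊆_) (sym σ≡) (Sublist.++⁺ˡ _ ⊆-refl)) av)
  ...   | c , refl , refl = p ∷ c , σ≡ , size

-- Every part except possibly the last is positive: all blocks but the last have size ≥ 2.
AllButLastPositive : List ℕ → Set
AllButLastPositive []          = ⊤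
AllButLastPositive (_ ∷ [])    = ⊤
AllButLastPositive (p ∷ q ∷ c) = 1 ≤ p × AllButLastPositive (q ∷ c)

-- A composition is admissible when none of its interior blocks has size 1.
Admissible : List ℕ → Set
Admissible []      = ⊤
Admissible (_ ∷ c) = AllButLastPositive c

allButLastPositive⇒admissible : ∀ c → AllButLastPositive c → Admissible c
allButLastPositive⇒admissible []          _         = tt
allButLastPositive⇒admissible (_ ∷ [])    _         = tt
allButLastPositive⇒admissible (_ ∷ _ ∷ _) (_ , abl) = abl

Increasing : List ℕ → Set
Increasing []          = ⊤
Increasing (_ ∷ [])    = ⊤
Increasing (x ∷ y ∷ l) = x < y × Increasing (y ∷ l)

interval-increasing : ∀ lo n → Increasing (interval lo n)
interval-increasing lo zero          = tt
interval-increasing lo (suc zero)    = tt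
interval-increasing lo (suc (suc n)) = ≤-refl , interval-increasing (suc lo) (suc n)

dd-after-ascent : ∀ {x y r} → x < y → HasDoubleDescent (x ∷ y ∷ r) → HasDoubleDescent (y ∷ r)
dd-after-ascent x<y (here y<x _) = ⊥-elim (<-asym x<y y<x)
dd-after-ascent x<y (there dd)   = dd

-- An increasing word followed by the layered permutation of c, all of whose blocks
-- but the last have size ≥ 2, has no double descent: descents occur only between
-- blocks, and each is followed by an ascent unless the block after it is the last one.
no-dd-increasing-++-layered : ∀ c L → AllButLastPositive c → Increasing L → ¬ HasDoubleDescent (L ++ layered c)
no-dd-increasing-++-layered c (x ∷ y ∷ L) abl (x<y , inc) dd =
  no-dd-increasing-++-layered c (y ∷ L) abl inc (dd-after-ascent x<y dd)
no-dd-increasing-++-layered []                (x ∷ []) abl inc (there ())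
no-dd-increasing-++-layered (suc q ∷ c)       (x ∷ []) abl inc (here _ t+1<t) = <-asym (n<1+n _) t+1<t
no-dd-increasing-++-layered (suc q ∷ c)       (x ∷ []) abl inc (there dd) =
  no-dd-increasing-++-layered (suc q ∷ c) [] abl tt dd
no-dd-increasing-++-layered (zero ∷ [])       (x ∷ []) abl inc (there (there ()))
no-dd-increasing-++-layered (zero ∷ _ ∷ _)    (x ∷ []) (() , _) inc dd
no-dd-increasing-++-layered []                []       abl inc ()
no-dd-increasing-++-layered (p ∷ c)           []       abl inc dd =
  no-dd-increasing-++-layered c (interval (suc (total c)) (suc p)) (allButLastPositive⇒admissible (p ∷ c) abl)
    (interval-increasing _ _) dd

admissible⇒no-dd : ∀ c → Admissible c → ¬ HasDoubleDescent (layered c)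
admissible⇒no-dd []      _   ()
admissible⇒no-dd (p ∷ c) adm = no-dd-increasing-++-layered c (interval (suc (total c)) (suc p)) adm (interval-increasing _ _)

dd-++ : ∀ (xs : List ℕ) {ys} → HasDoubleDescent ys → HasDoubleDescent (xs ++ ys)
dd-++ []       dd = dd
dd-++ (x ∷ xs) dd = there (dd-++ xs dd)

dd-after-run : ∀ lo len y z zs → y < lo + len → z < y → HasDoubleDescent (interval lo (suc len) ++ y ∷ z ∷ zs)
dd-after-run lo zero      y z zs y<end z<y = here (subst (y <_) (+-identityʳ lo) y<end) z<y
dd-after-run lo (suc len) y z zs y<end z<y = there (dd-after-run (suc lo) len y z zs (subst (y <_) (+-suc lo len) y<end) z<y)

-- Conversely an interior block of size 1 creates a double descent with the last letter
-- of the block before it and the first letter of the block after it.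
no-dd⇒admissible : ∀ c → ¬ HasDoubleDescent (layered c) → Admissible c
no-dd⇒admissible []      _  = tt
no-dd⇒admissible (p ∷ c) nd = interior p c nd
  where
  interior : ∀ p c → ¬ HasDoubleDescent (layered (p ∷ c)) → AllButLastPositive c
  interior p []                _  = tt
  interior p (_ ∷ [])          _  = tt
  interior p (zero ∷ r ∷ c)    nd = ⊥-elim (nd (dd-after-run (suc (suc (total (r ∷ c)))) p _ _ _
    (m≤m+n (suc (suc (total (r ∷ c)))) p) (s≤s (s≤s (m≤n+m (total c) r)))))
  interior p (suc q ∷ r ∷ c)   nd = s≤s z≤n , interior (suc q) (r ∷ c) (nd ∘ dd-++ (interval _ (suc p)))

restrict-interval : ∀ k lo len → restrict k (interval lo len) ≡ interval lo (len ⊓ (suc k ∸ lo))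
restrict-interval k lo zero      = refl
restrict-interval k lo (suc len) with lo ≤? k
... | yes lo≤k = begin
  restrict k (interval lo (suc len))        ≡⟨ List.filter-accept (_≤? k) lo≤k ⟩
  lo ∷ restrict k (interval (suc lo) len)   ≡⟨ cong (lo ∷_) (restrict-interval k (suc lo) len) ⟩
  interval lo (suc (len ⊓ (k ∸ lo)))        ≡⟨ cong (λ m → interval lo (suc len ⊓ m)) (+-∸-assoc 1 lo≤k) ⟨
  interval lo (suc len ⊓ (suc k ∸ lo))      ∎
  where open ≡-Reasoning
... | no  lo≰k = begin
  restrict k (interval lo (suc len))        ≡⟨ List.filter-reject (_≤? k) lo≰k ⟩
  restrict k (interval (suc lo) len)        ≡⟨ restrict-interval k (suc lo) len ⟩
  interval (suc lo) (len ⊓ (k ∸ lo))        ≡⟨ cong (λ m → interval (suc lo) (len ⊓ m)) (m≤n⇒m∸n≡0 (<⇒≤ k<lo)) ⟩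
  interval (suc lo) (len ⊓ 0)               ≡⟨ cong (interval (suc lo)) (⊓-zeroʳ len) ⟩
  []                                        ≡⟨ cong (λ m → interval lo (suc len ⊓ m)) (m≤n⇒m∸n≡0 k<lo) ⟨
  interval lo (suc len ⊓ (suc k ∸ lo))      ∎
  where
  open ≡-Reasoning
  k<lo = ≰⇒> lo≰k

-- Restricting a layered permutation to the letters ≤ k drops the blocks above k and
-- cuts the block containing k: the result is again layered, and admissible if c is.
restrict-layered : ∀ k c → Admissible c → ∃ λ c' → restrict k (layered c) ≡ layered c' × Admissible c'
restrict-layered k []      _   = [] , refl , tt
restrict-layered k (p ∷ c) adm with k ≤? total c
... | yes k≤tc with restrict-layered k c (allButLastPositive⇒admissible c adm)
...   | c' , c'≡ , adm' = c' , trans (List.filter-++ (_≤? k) top (layered c)) (cong₂ _++_ top-vanishes c'≡) , adm'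
  where
  top = interval (suc (total c)) (suc p)
  top-vanishes : restrict k top ≡ []
  top-vanishes = trans (restrict-interval k (suc (total c)) (suc p))
                       (cong (λ m → interval (suc (total c)) (suc p ⊓ m)) (m≤n⇒m∸n≡0 k≤tc))
restrict-layered k (p ∷ c) adm | no k≰tc =
  p ⊓ (k ∸ suc (total c)) ∷ c , trans (List.filter-++ (_≤? k) top (layered c)) (cong₂ _++_ top-cut rest-kept) , adm
  where
  top = interval (suc (total c)) (suc p)
  tc<k = ≰⇒> k≰tc
  top-cut : restrict k top ≡ interval (suc (total c)) (suc (p ⊓ (k ∸ suc (total c))))
  top-cut = trans (restrict-interval k (suc (total c)) (suc p))
                  (cong (λ m → interval (suc (total c)) (suc p ⊓ m)) (+-∸-assoc 1 tc<k))
  rest-kept : restrict k (layered c) ≡ layered c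
  rest-kept = List.filter-all (_≤? k) (All.tabulate (λ w∈ → ≤-trans (s≤s⁻¹ (proj₂ (∈-layered⁻ c w∈))) (<⇒≤ tc<k)))

admissible⇒simsun : ∀ c → Admissible c → Simsun (layered c)
admissible⇒simsun c adm k with restrict-layered k c adm
... | c' , c'≡ , adm' = admissible⇒no-dd c' adm' ∘ subst HasDoubleDescent c'≡

simsun⇒no-dd : ∀ n σ → σ ↭ interval 1 n → Simsun σ → ¬ HasDoubleDescent σ
simsun⇒no-dd n σ σ↭ simsun =
  simsun n ∘ subst HasDoubleDescent (sym (List.filter-all (_≤? n) (All.tabulate (s≤s⁻¹ ∘ proj₂ ∘ ∈-interval⁻ 1 n ∘ ∈-resp-↭ σ↭))))

position-head : ∀ x (xs : List ℕ) → position x (x ∷ xs) ≡ 1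
position-head x xs with x ≟ x
... | yes _   = refl
... | no  x≢x = ⊥-elim (x≢x refl)

position-++ : ∀ j (xs : List ℕ) {ys} → (∀ {x} → x ∈ xs → j ≢ x) → position j (xs ++ ys) ≡ length xs + position j ys
position-++ j []       j∉ = refl
position-++ j (x ∷ xs) j∉ with j ≟ x
... | yes j≡x = ⊥-elim (j∉ (here refl) j≡x)
... | no  _   = cong suc (position-++ j xs (j∉ ∘ there))

map-shift-interval : ∀ k lo len → map (k +_) (interval lo len) ≡ interval (k + lo) len
map-shift-interval k lo zero      = refl
map-shift-interval k lo (suc len) =
  cong (k + lo ∷_) (trans (map-shift-interval k (suc lo) len) (cong (λ l → interval l len) (+-suc k lo)))

positions-in-run : ∀ lo len ys → map (λ j → position j (interval lo len ++ ys)) (interval lo len) ≡ interval 1 len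
positions-in-run lo zero      ys = refl
positions-in-run lo (suc len) ys = cong₂ _∷_ (position-head lo rest) (begin
  map (λ j → position j (lo ∷ rest)) (interval (suc lo) len)  ≡⟨ List.map-cong-local (All.tabulate behind-lo) ⟩
  map (suc ∘ λ j → position j rest) (interval (suc lo) len)   ≡⟨ List.map-∘ (interval (suc lo) len) ⟩
  map suc (map (λ j → position j rest) (interval (suc lo) len)) ≡⟨ cong (map suc) (positions-in-run (suc lo) len ys) ⟩
  map suc (interval 1 len)                                    ≡⟨ map-shift-interval 1 1 len ⟩
  interval 2 len                                              ∎)
  where
  open ≡-Reasoning
  rest = interval (suc lo) len ++ ys
  behind-lo : ∀ {j} → j ∈ interval (suc lo) len → position j (lo ∷ rest) ≡ suc (position j rest)
  behind-lo j∈ = position-++ _ (lo ∷ []) λ { (here refl) refl → <-irrefl refl (proj₁ (∈-interval⁻ (suc lo) len j∈)) }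

layered-snoc : ∀ d p → layered (d ++ p ∷ []) ≡ map (suc p +_) (layered d) ++ interval 1 (suc p)
layered-snoc []      p = List.++-identityʳ (interval 1 (suc p))
layered-snoc (q ∷ d) p = begin
  interval (suc (total (d ++ p ∷ []))) (suc q) ++ layered (d ++ p ∷ [])
    ≡⟨ cong₂ _++_ shifted-top (layered-snoc d p) ⟩
  map (suc p +_) top ++ map (suc p +_) (layered d) ++ interval 1 (suc p)
    ≡⟨ List.++-assoc (map (suc p +_) top) _ _ ⟨
  (map (suc p +_) top ++ map (suc p +_) (layered d)) ++ interval 1 (suc p)
    ≡⟨ cong (_++ interval 1 (suc p)) (List.map-++ (suc p +_) top (layered d)) ⟨
  map (suc p +_) (layered (q ∷ d)) ++ interval 1 (suc p) ∎
  where
  open ≡-Reasoning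
  top = interval (suc (total d)) (suc q)
  total-snoc : ∀ d → total (d ++ p ∷ []) ≡ total d + suc p
  total-snoc []      = +-identityʳ (suc p)
  total-snoc (r ∷ d) = trans (cong (suc r +_) (total-snoc d)) (sym (+-assoc (suc r) (total d) (suc p)))
  shifted-top : interval (suc (total (d ++ p ∷ []))) (suc q) ≡ map (suc p +_) top
  shifted-top = trans (cong (λ t → interval t (suc q)) (trans (cong suc (trans (total-snoc d) (+-comm (total d) (suc p))))
                                                             (sym (+-suc (suc p) (total d)))))
                      (sym (map-shift-interval (suc p) (suc (total d)) (suc q)))

-- In layered (p ∷ c) the values 1, …, total c come after the first block and sit in the
-- order prescribed by layered c, while the values of the first block occupy the first
-- positions; hence the inverse is layered with the blocks in reverse order.
positions-layered : ∀ c → map (λ j → position j (layered c)) (interval 1 (total c)) ≡ layered (reverse c)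
positions-layered []      = refl
positions-layered (p ∷ c) = begin
  map pos (interval 1 (total (p ∷ c)))                          ≡⟨ cong (map pos) (interval-split m (suc p)) ⟨
  map pos (interval 1 m ++ top)                                 ≡⟨ List.map-++ pos (interval 1 m) top ⟩
  map pos (interval 1 m) ++ map pos top                         ≡⟨ cong₂ _++_ lower-values (positions-in-run (suc m) (suc p) (layered c)) ⟩
  map (suc p +_) (layered (reverse c)) ++ interval 1 (suc p)    ≡⟨ layered-snoc (reverse c) p ⟨
  layered (reverse c ++ p ∷ [])                                 ≡⟨ cong layered (List.unfold-reverse p c) ⟨
  layered (reverse (p ∷ c))                                     ∎
  where
  open ≡-Reasoning
  m = total c
  top = interval (suc m) (suc p)
  pos : ℕ → ℕ
  pos j = position j (layered (p ∷ c))
  behind-top : ∀ {j} → j ∈ interval 1 m → pos j ≡ suc p + position j (layered c)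
  behind-top {j} j∈ = trans (position-++ j top j∉top) (cong (_+ position j (layered c)) (length-interval (suc m) (suc p)))
    where
    j∉top : ∀ {x} → x ∈ top → j ≢ x
    j∉top x∈ refl = <-irrefl refl (≤-trans (proj₂ (∈-interval⁻ 1 m j∈)) (proj₁ (∈-interval⁻ (suc m) (suc p) x∈)))
  lower-values : map pos (interval 1 m) ≡ map (suc p +_) (layered (reverse c))
  lower-values = begin
    map pos (interval 1 m)                                             ≡⟨ List.map-cong-local (All.tabulate behind-top) ⟩
    map ((suc p +_) ∘ λ j → position j (layered c)) (interval 1 m)     ≡⟨ List.map-∘ (interval 1 m) ⟩
    map (suc p +_) (map (λ j → position j (layered c)) (interval 1 m)) ≡⟨ cong (map (suc p +_)) (positions-layered c) ⟩
    map (suc p +_) (layered (reverse c))                               ∎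

inverse-layered : ∀ c → inverse (layered c) ≡ layered (reverse c)
inverse-layered c = trans (cong (map (λ j → position j (layered c)))
                                (trans ([1‥n]≡interval (length (layered c))) (cong (interval 1) (length-layered c))))
                          (positions-layered c)

allButLastPositive-snoc⁻ : ∀ d r → AllButLastPositive (d ++ r ∷ []) → All (1 ≤_) d
allButLastPositive-snoc⁻ []          r _           = []
allButLastPositive-snoc⁻ (x ∷ [])    r (1≤x , _)   = 1≤x ∷ []
allButLastPositive-snoc⁻ (x ∷ y ∷ d) r (1≤x , abl) = 1≤x ∷ allButLastPositive-snoc⁻ (y ∷ d) r abl

allButLastPositive-snoc⁺ : ∀ d r → All (1 ≤_) d → AllButLastPositive (d ++ r ∷ [])
allButLastPositive-snoc⁺ []          r []               = tt
allButLastPositive-snoc⁺ (x ∷ [])    r (1≤x ∷ [])       = 1≤x , tt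
allButLastPositive-snoc⁺ (x ∷ y ∷ d) r (1≤x ∷ positive) = 1≤x , allButLastPositive-snoc⁺ (y ∷ d) r positive

-- Admissibility is invariant under reversing the composition: the interior parts of
-- p ∷ d ++ [r] are those of d.
admissible-reverse : ∀ c → Admissible c → Admissible (reverse c)
admissible-reverse []      _ = tt
admissible-reverse (p ∷ c) adm with initLast c
... | []       = tt
... | d ∷ʳ′ r  = subst Admissible (sym reversed)
  (allButLastPositive-snoc⁺ (reverse d) p (All-resp-↭ (↭-sym (↭-reverse d)) (allButLastPositive-snoc⁻ d r adm)))
  where
  reversed : reverse (p ∷ d ++ r ∷ []) ≡ r ∷ reverse d ++ p ∷ []
  reversed = trans (List.unfold-reverse p (d ++ r ∷ [])) (cong (_++ p ∷ []) (List.reverse-++ d (r ∷ [])))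

growFirst : List ℕ → List ℕ
growFirst []      = 0 ∷ []
growFirst (p ∷ c) = suc p ∷ c

total-growFirst : ∀ d → total (growFirst d) ≡ suc (total d)
total-growFirst []      = refl
total-growFirst (p ∷ c) = refl

growFirst-injective : ∀ {c d} → growFirst c ≡ growFirst d → c ≡ d
growFirst-injective {[]}    {[]}    _    = refl
growFirst-injective {_ ∷ _} {_ ∷ _} refl = refl
growFirst-injective {[]}    {_ ∷ _} ()
growFirst-injective {_ ∷ _} {[]}    ()

growFirst-allButLastPositive : ∀ d → Admissible d → AllButLastPositive (growFirst d)
growFirst-allButLastPositive []          _   = tt
growFirst-allButLastPositive (p ∷ [])    _   = tt
growFirst-allButLastPositive (p ∷ q ∷ c) adm = s≤s z≤n , adm

-- The admissible compositions of n, sorted by the first block: it has size ≥ 2 (grow the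
-- first block of an admissible composition of n-1), or it has size 1 and is followed by
-- the grown first block of an admissible composition of n-2.
admissibleCompositions : ℕ → List (List ℕ)
admissibleCompositions zero          = [] ∷ []
admissibleCompositions (suc zero)    = (0 ∷ []) ∷ []
admissibleCompositions (suc (suc n)) =
  map growFirst (admissibleCompositions (suc n)) ++ map (λ d → 0 ∷ growFirst d) (admissibleCompositions n)

length-admissibleCompositions : ∀ n → length (admissibleCompositions n) ≡ F (suc n)
length-admissibleCompositions zero          = refl
length-admissibleCompositions (suc zero)    = refl
length-admissibleCompositions (suc (suc n)) = begin
  length (map growFirst A₁ ++ map (λ d → 0 ∷ growFirst d) A₀)         ≡⟨ List.length-++ (map growFirst A₁) ⟩
  length (map growFirst A₁) + length (map (λ d → 0 ∷ growFirst d) A₀) ≡⟨ cong₂ _+_ (List.length-map growFirst A₁) (List.length-map _ A₀) ⟩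
  length A₁ + length A₀                                                ≡⟨ cong₂ _+_ (length-admissibleCompositions (suc n)) (length-admissibleCompositions n) ⟩
  F (suc (suc n)) + F (suc n)                                          ∎
  where
  open ≡-Reasoning
  A₁ = admissibleCompositions (suc n)
  A₀ = admissibleCompositions n

admissibleCompositions-sound : ∀ n {c} → c ∈ admissibleCompositions n → Admissible c × total c ≡ n
admissibleCompositions-sound zero          (here refl) = tt , refl
admissibleCompositions-sound (suc zero)    (here refl) = tt , refl
admissibleCompositions-sound (suc (suc n)) =
  extend (admissibleCompositions-sound (suc n)) (admissibleCompositions-sound n)
  where
  extend : (∀ {d} → d ∈ admissibleCompositions (suc n) → Admissible d × total d ≡ suc n)
         → (∀ {d} → d ∈ admissibleCompositions n → Admissible d × total d ≡ n)
         → ∀ {c} → c ∈ admissibleCompositions (suc (suc n)) → Admissible c × total c ≡ suc (suc n)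
  extend sound₁ sound₀ c∈ with ∈-++⁻ (map growFirst (admissibleCompositions (suc n))) c∈
  ... | inj₁ c∈₁ with ∈-map⁻ growFirst c∈₁
  ...   | d , d∈ , refl = allButLastPositive⇒admissible (growFirst d) (growFirst-allButLastPositive d (proj₁ (sound₁ d∈)))
                        , trans (total-growFirst d) (cong suc (proj₂ (sound₁ d∈)))
  extend sound₁ sound₀ c∈ | inj₂ c∈₂ with ∈-map⁻ (λ d → 0 ∷ growFirst d) c∈₂
  ...   | d , d∈ , refl = growFirst-allButLastPositive d (proj₁ (sound₀ d∈))
                        , cong suc (trans (total-growFirst d) (cong suc (proj₂ (sound₀ d∈))))

admissibleCompositions-complete : ∀ n c → Admissible c → total c ≡ n → c ∈ admissibleCompositions n
admissibleCompositions-complete zero          []                    _   _    = here refl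
admissibleCompositions-complete (suc zero)    (zero ∷ [])           _   _    = here refl
admissibleCompositions-complete (suc (suc n)) (suc p ∷ c)           adm size =
  ∈-++⁺ˡ (∈-map⁺ growFirst (admissibleCompositions-complete (suc n) (p ∷ c) adm (suc-injective size)))
admissibleCompositions-complete (suc (suc .0)) (zero ∷ zero ∷ [])   _   refl = there (here refl)
admissibleCompositions-complete (suc (suc n)) (zero ∷ suc q ∷ c)    adm size =
  ∈-++⁺ʳ (map growFirst (admissibleCompositions (suc n)))
    (∈-map⁺ (λ d → 0 ∷ growFirst d)
      (admissibleCompositions-complete n (q ∷ c) (allButLastPositive⇒admissible (suc q ∷ c) adm)
        (suc-injective (suc-injective size))))
admissibleCompositions-complete (suc (suc n)) (zero ∷ zero ∷ _ ∷ _) (() , _) _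
admissibleCompositions-complete zero          (_ ∷ _)               _   ()
admissibleCompositions-complete (suc _)       []                    _   ()
admissibleCompositions-complete (suc zero)    (suc _ ∷ _)           _   ()
admissibleCompositions-complete (suc zero)    (zero ∷ _ ∷ _)        _   ()
admissibleCompositions-complete (suc (suc _)) (zero ∷ [])           _   ()

admissibleCompositions-unique : ∀ n → Unique (admissibleCompositions n)
admissibleCompositions-unique zero          = [] ∷ []
admissibleCompositions-unique (suc zero)    = [] ∷ []
admissibleCompositions-unique (suc (suc n)) = Unique.++⁺
  (Unique.map⁺ growFirst-injective (admissibleCompositions-unique (suc n)))
  (Unique.map⁺ (growFirst-injective ∘ List.∷-injectiveʳ) (admissibleCompositions-unique n))
  (λ (c∈₁ , c∈₂) → first-blocks-differ c∈₁ c∈₂)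
  where
  first-blocks-differ : ∀ {c} → c ∈ map growFirst (admissibleCompositions (suc n))
    → c ∈ map (λ d → 0 ∷ growFirst d) (admissibleCompositions n) → ⊥
  first-blocks-differ c∈₁ c∈₂ with ∈-map⁻ growFirst c∈₁ | ∈-map⁻ (λ d → 0 ∷ growFirst d) c∈₂
  ... | []    , _ , refl | []    , _ , ()
  ... | []    , _ , refl | _ ∷ _ , _ , ()
  ... | _ ∷ _ , _ , refl | _     , _ , ()

DRS⇔admissible-layered : ∀ n σ → InDRS n σ ⇔ ∃ λ c → Admissible c × total c ≡ n × σ ≡ layered c
DRS⇔admissible-layered n σ = mk⇔ to from
  where
  to : InDRS n σ → ∃ λ c → Admissible c × total c ≡ n × σ ≡ layered c
  to (σ∈𝔖ₙ , av₁ , av₂ , simsun , _) with avoider-is-layered n σ (isPerm⇒↭interval σ∈𝔖ₙ) (av₁ , av₂)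
  ... | c , σ≡ , size =
    c , no-dd⇒admissible c (no-dd ∘ subst HasDoubleDescent (sym σ≡)) , size , σ≡
    where no-dd = simsun⇒no-dd n σ (isPerm⇒↭interval σ∈𝔖ₙ) simsun
  from : (∃ λ c → Admissible c × total c ≡ n × σ ≡ layered c) → InDRS n σ
  from (c , adm , refl , refl) =
      subst (layered c ↭_) (sym ([1‥n]≡interval (total c))) (layered-↭ c)
    , proj₁ (layered-avoids c) , proj₂ (layered-avoids c)
    , admissible⇒simsun c adm
    , subst Simsun (sym (inverse-layered c)) (admissible⇒simsun (reverse c) (admissible-reverse c adm))

-- 𝒟ℛ𝒮ₙ(132,213) is listed without repetition by the layered permutations of the
-- admissible compositions of n (the count holds for n = 0 as well).
theorem3p7 : (n : ℕ) → n ≥ 1 →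
    Σ (List (List ℕ)) (λ L → Unique L × (∀ σ → (σ ∈ L) ⇔ InDRS n σ) × length L ≡ F (suc n))
theorem3p7 n _ =
    map layered (admissibleCompositions n)
  , Unique.map⁺ (layered-injective _ _) (admissibleCompositions-unique n)
  , (λ σ → mk⇔ (Equivalence.from (DRS⇔admissible-layered n σ) ∘ listed⇒admissible σ)
               (admissible⇒listed σ ∘ Equivalence.to (DRS⇔admissible-layered n σ)))
  , trans (List.length-map layered (admissibleCompositions n)) (length-admissibleCompositions n)
  where
  listed⇒admissible : ∀ σ → σ ∈ map layered (admissibleCompositions n) → ∃ λ c → Admissible c × total c ≡ n × σ ≡ layered c
  listed⇒admissible σ σ∈ with ∈-map⁻ layered σ∈
  ... | c , c∈ , σ≡ = c , proj₁ (admissibleCompositions-sound n c∈) , proj₂ (admissibleCompositions-sound n c∈) , σ≡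
  admissible⇒listed : ∀ σ → (∃ λ c → Admissible c × total c ≡ n × σ ≡ layered c) → σ ∈ map layered (admissibleCompositions n)
  admissible⇒listed σ (c , adm , size , refl) = ∈-map⁺ layered (admissibleCompositions-complete n c adm size)
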